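{- Let $S\subseteq\mathbb{N}$ be a unary numerical relation and $S+1=\{k+1:k\in S\}$. Then $\mathrm{RC}(\mathrm{FO}_{\{\le,S\}})\equiv\mathrm{FO}_{\le}(\mathsf{C}_{S+1})$.
   Context: A numerical relation is a relation on $\mathbb{N}$. A br-$\tau$-model is a pair $(\mathfrak{M},f)$ with $\mathfrak{M}$ a finite $\tau$-structure and $f\colon\mathrm{Dom}(\mathfrak{M})\to\{0,\dots,|\mathrm{Dom}(\mathfrak{M})|-1\}$ a bijection; numerical relations $S$ are interpreted as $S^f=\{\bar a:f(\bar a)\in S\}$. $\mathrm{FO}_{\mathcal{B}}$ is first-order logic with the relations in $\mathcal{B}$ as built-in relations. $\mathcal{L}\le\mathcal{L}'$ if every class of br-$\tau$-models definable in $\mathcal{L}$ is definable in $\mathcal{L}'$; $\equiv$ means both directions. The cardinality quantifier $\mathsf{C}_T$: $\mathsf{C}_T x\,\psi(x)$ holds iff $|\psi^{\mathfrak{M},f}|\in T$. A br-quantifier $Q$ of vocabulary $\tau$ is a class $K_Q$ of br-$\tau$-models closed under isomorphisms $h$ with $f=g\circ h$, with $(\mathfrak{M},f)\models Q(\bar x_R\psi_R)_{R\in\tau}$ iff $(\mathrm{Dom}(\mathfrak{M}),(\psi_R^{\mathfrak{M},f})_{R\in\tau},f)\in K_Q$; it is definable in a logic if $K_Q$ is. Relativization: $(\mathfrak{M},f)|U=(\mathfrak{M}|U,f_U)$, with $\mathfrak{M}|U$ the induced substructure on nonempty $U$ and $f_U\colon U\to\{0,\dots,|U|-1\}$ the bijection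 preserving the order induced by $f$. The regularization $Q^{\mathrm{reg}}$ has vocabulary $\tau\cup\{P\}$ ($P$ new unary) and class $\{(\mathfrak{M},f):((\mathfrak{M},f)|P^{\mathfrak{M}})\restriction\tau\in K_Q\}$. For a logic $\mathcal{L}_{\mathcal{B}}$ in which $\le$ is definable, $\mathrm{RC}(\mathcal{L}_{\mathcal{B}})=\mathrm{FO}_{\le}(\{Q^{\mathrm{reg}}: Q \text{ a br-quantifier definable in }\mathcal{L}_{\mathcal{B}}\})$. -}

module Defs where

open import Data.Nat using (ℕ; zero; suc; _+_; _≤ᵇ_)
open import Data.Bool using (Bool; true; false; _∧_; _∨_; not; if_then_else_)
open import Data.Fin using (Fin; zero; suc; toℕ; _≟_)
open import Data.List using (List; []; _∷_; length; map)
open import Data.Vec using (Vec; []; _∷_; lookup; _++_)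
import Data.Vec as V
open import Data.Product using (Σ; _×_; _,_)
open import Relation.Binary.PropositionalEquality using (_≡_)
open import Relation.Nullary.Decidable using (⌊_⌋)
open import Function using (_∘_)
open import Function.Bundles using (_↔_; Inverse)
open import Function.Properties.Inverse using (↔-refl)

-- A relational vocabulary: the list of arities of its relation symbols.
Voc : Set
Voc = List ℕ

Sym : Voc → Set
Sym τ = Fin (length τ)

ar : (τ : Voc) → Sym τ → ℕ
ar τ i = Data.List.lookup τ i

-- A br-τ-model (𝔐, f): a finite (nonempty) τ-structure with universe
-- Fin (suc size-1), together with a bijection f onto {0,…,|M|-1}.
record BrModel (τ : Voc) : Set where
  field
    size-1 : ℕ
    ord    : Fin (suc size-1) ↔ Fin (suc size-1)
    rel    : (i : Sym τ) → Vec (Fin (suc size-1)) (ar τ i) → Bool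

  Dom : Set
  Dom = Fin (suc size-1)

  f : Dom → ℕ
  f a = toℕ (Inverse.to ord a)

open BrModel public

anyFin : ∀ {n} → (Fin n → Bool) → Bool
anyFin {zero}  p = false
anyFin {suc n} p = p zero ∨ anyFin (p ∘ suc)

countFin : ∀ {n} → (Fin n → Bool) → ℕ
countFin {zero}  p = 0
countFin {suc n} p = (if p zero then 1 else 0) + countFin (p ∘ suc)

select : ∀ {n} → (Fin n → Bool) → List (Fin n)
select {zero}  p = []
select {suc n} p =
  if p zero then zero ∷ map suc (select (p ∘ suc)) else map suc (select (p ∘ suc))

inSucc : (ℕ → Bool) → ℕ → Bool
inSucc S zero    = false
inSucc S (suc c) = S c

-- FO_{≤,S}: first-order logic with built-in numerical relations ≤ and S
-- (de Bruijn variables; formulas with k free variables)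

data FOleS (τ : Voc) : ℕ → Set where
  eqF  : ∀ {k} → Fin k → Fin k → FOleS τ k
  relF : ∀ {k} (i : Sym τ) → Vec (Fin k) (ar τ i) → FOleS τ k
  leF  : ∀ {k} → Fin k → Fin k → FOleS τ k
  SF   : ∀ {k} → Fin k → FOleS τ k
  negF : ∀ {k} → FOleS τ k → FOleS τ k
  andF : ∀ {k} → FOleS τ k → FOleS τ k → FOleS τ k
  exF  : ∀ {k} → FOleS τ (suc k) → FOleS τ k

evalFO : (S : ℕ → Bool) → ∀ {τ k} → FOleS τ k → (M : BrModel τ) → Vec (Dom M) k → Bool
evalFO S (eqF x y)   M e = ⌊ lookup e x ≟ lookup e y ⌋
evalFO S (relF i xs) M e = rel M i (V.map (lookup e) xs)
evalFO S (leF x y)   M e = f M (lookup e x) ≤ᵇ f M (lookup e y)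
evalFO S (SF x)      M e = S (f M (lookup e x))
evalFO S (negF φ)    M e = not (evalFO S φ M e)
evalFO S (andF φ ψ)  M e = evalFO S φ M e ∧ evalFO S ψ M e
evalFO S (exF φ)     M e = anyFin (λ a → evalFO S φ M (a ∷ e))

-- RC(FO_{≤,S}) = FO_≤({Q^reg : Q definable in FO_{≤,S}})
-- A br-quantifier Q of vocabulary σ definable in FO_{≤,S} is given by a
-- defining FO_{≤,S}-sentence φ over σ (K_Q = models of φ).
-- Q^reg applied to: a formula for P (binding one variable) and, for each
-- R ∈ σ, a formula ψ_R binding ar(R) variables (other free vars = parameters).

data RC (S : ℕ → Bool) (τ : Voc) : ℕ → Set where
  eqR  : ∀ {k} → Fin k → Fin k → RC S τ k
  relR : ∀ {k} (i : Sym τ) → Vec (Fin k) (ar τ i) → RC S τ k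
  leR  : ∀ {k} → Fin k → Fin k → RC S τ k
  negR : ∀ {k} → RC S τ k → RC S τ k
  andR : ∀ {k} → RC S τ k → RC S τ k → RC S τ k
  exR  : ∀ {k} → RC S τ (suc k) → RC S τ k
  qreg : ∀ {k} (σ : Voc) (φ : FOleS σ 0) →
         RC S τ (suc k) → ((i : Sym σ) → RC S τ (ar σ i + k)) → RC S τ k

-- Relativization (𝔐,f)|U (used in evalQreg below) for U = {a : P(a)} nonempty, presented on the
-- universe Fin |U| with the elements of U listed in increasing f-order
-- (so f_U becomes the identity), with σ-relations given by ψ_R.
-- The evaluation of Q^reg: false if U is empty, otherwise whether the
-- relativized σ-model satisfies φ.
evalQreg : (S : ℕ → Bool) → ∀ {n} σ (φ : FOleS σ 0) (ordM : Fin (suc n) ↔ Fin (suc n)) →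
           (P : Fin (suc n) → Bool) →
           ((i : Sym σ) → Vec (Fin (suc n)) (ar σ i) → Bool) → Bool
evalQreg S {n} σ φ ordM P ψ = go (select (λ p → P (Inverse.from ordM p)))
  where
  go : List (Fin (suc n)) → Bool
  go []       = false
  go (x ∷ xs) = evalFO S φ N []
    where
    g : Fin (suc (length xs)) → Fin (suc n)
    g j = Inverse.from ordM (Data.List.lookup (x ∷ xs) j)
    N : BrModel σ
    N = record { size-1 = length xs
               ; ord = ↔-refl
               ; rel = λ i us → ψ i (V.map g us) }

evalRC : (S : ℕ → Bool) → ∀ {τ k} → RC S τ k → (M : BrModel τ) → Vec (Dom M) k → Bool
evalRC S (eqR x y)   M e = ⌊ lookup e x ≟ lookup e y ⌋
evalRC S (relR i xs) M e = rel M i (V.map (lookup e) xs)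
evalRC S (leR x y)   M e = f M (lookup e x) ≤ᵇ f M (lookup e y)
evalRC S (negR φ)    M e = not (evalRC S φ M e)
evalRC S (andR φ ψ)  M e = evalRC S φ M e ∧ evalRC S ψ M e
evalRC S (exR φ)     M e = anyFin (λ a → evalRC S φ M (a ∷ e))
evalRC S (qreg σ φ P ψ) M e =
  evalQreg S σ φ (ord M) (λ a → evalRC S P M (a ∷ e))
                         (λ i us → evalRC S (ψ i) M (us ++ e))

-- FO_≤(C_{S+1}): first-order logic with built-in ≤ and the cardinality
-- quantifier C_{S+1} x ψ  (holds iff |ψ^{𝔐,f}| ∈ S+1)

data FOC (τ : Voc) : ℕ → Set where
  eqC  : ∀ {k} → Fin k → Fin k → FOC τ k
  relC : ∀ {k} (i : Sym τ) → Vec (Fin k) (ar τ i) → FOC τ k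
  leC  : ∀ {k} → Fin k → Fin k → FOC τ k
  negC : ∀ {k} → FOC τ k → FOC τ k
  andC : ∀ {k} → FOC τ k → FOC τ k → FOC τ k
  exC  : ∀ {k} → FOC τ (suc k) → FOC τ k
  cntC : ∀ {k} → FOC τ (suc k) → FOC τ k

evalC : (S : ℕ → Bool) → ∀ {τ k} → FOC τ k → (M : BrModel τ) → Vec (Dom M) k → Bool
evalC S (eqC x y)   M e = ⌊ lookup e x ≟ lookup e y ⌋
evalC S (relC i xs) M e = rel M i (V.map (lookup e) xs)
evalC S (leC x y)   M e = f M (lookup e x) ≤ᵇ f M (lookup e y)
evalC S (negC φ)    M e = not (evalC S φ M e)
evalC S (andC φ ψ)  M e = evalC S φ M e ∧ evalC S ψ M e
evalC S (exC φ)     M e = anyFin (λ a → evalC S φ M (a ∷ e))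
evalC S (cntC φ)    M e = inSucc S (countFin (λ a → evalC S φ M (a ∷ e)))

-- Comparison of logics: L ≤ L' iff every class of br-τ-models definable
-- by an L-sentence is definable by an L'-sentence (for every vocabulary τ).

RC≤FOC : (ℕ → Bool) → Set
RC≤FOC S = (τ : Voc) (φ : RC S τ 0) →
  Σ (FOC τ 0) (λ ψ → (M : BrModel τ) → evalRC S φ M [] ≡ evalC S ψ M [])

FOC≤RC : (ℕ → Bool) → Set
FOC≤RC S = (τ : Voc) (ψ : FOC τ 0) →
  Σ (RC S τ 0) (λ φ → (M : BrModel τ) → evalC S ψ M [] ≡ evalRC S φ M [])

-- A regularized quantifier Q^reg applied to P and φ becomes
-- ∃x P x ∧ φ^P, where φ^P relativizes the quantifiers of φ to P and replaces S x by
-- C_{S+1} y (P y ∧ y ≤ x): in (𝔐,f)|P the position of x is one less than the number of P-elements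
-- up to x. Conversely, C_{S+1} x ψ is Q^reg, relativized to ψ, for the quantifier "the largest
-- element lies in S": a set of size t+1 has its largest element at position t, and for the empty
-- set both sides are false.
module Submission where

open import Defs
open import Data.Nat as ℕ using (ℕ; zero; suc; _+_; _≤ᵇ_; s≤s)
import Data.Nat.Properties as ℕ
open import Data.Bool using (Bool; true; false; T; _∧_; _∨_; not)
open import Data.Bool.Properties using (T-∧; T-∨; T?)
open import Data.Fin as F using (Fin; zero; suc; toℕ; _≟_; _↑ˡ_; _↑ʳ_)
import Data.Fin.Properties as F
open import Data.List as L using (List; []; _∷_; length; map)
import Data.List.Properties as L
open import Data.List.Membership.Propositional using (_∈_)
open import Data.List.Membership.Propositional.Properties
  using (∈-map⁺; ∈-map⁻; ∈-lookup; ∈-tabulate⁺; ∈-tabulate⁻)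
open import Data.List.Membership.Propositional.Properties.WithK using (unique∧set⇒bag)
open import Data.List.Relation.Binary.BagAndSetEquality using (∼bag⇒↭)
open import Data.List.Relation.Binary.Permutation.Propositional.Properties using (↭-length)
import Data.List.Relation.Unary.All as All
import Data.List.Relation.Unary.All.Properties as All
open import Data.List.Relation.Unary.AllPairs as AllPairs using (AllPairs; []; _∷_)
import Data.List.Relation.Unary.AllPairs.Properties as AllPairs
open import Data.List.Relation.Unary.Any as Any using (here; there)
open import Data.List.Relation.Unary.Any.Properties using (lookup-index)
open import Data.List.Relation.Unary.Unique.Propositional using (Unique)
open import Data.Vec as V using (Vec; []; _∷_; lookup; _++_)
import Data.Vec.Properties as V
open import Data.Product using (∃; _×_; _,_)
open import Data.Sum using (inj₁; inj₂; [_,_]′)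
open import Data.Empty using (⊥)
open import Relation.Nullary.Negation using (¬_)
open import Function using (_∘_)
open import Function.Bundles using (_⇔_; mk⇔; Equivalence; _↔_; Inverse)
open import Function.Properties.Inverse using (↔-refl)
open import Function.Properties.Equivalence using () renaming (trans to ⇔-trans; sym to ⇔-sym)
open import Relation.Binary.PropositionalEquality
open import Relation.Nullary.Decidable using (⌊_⌋; does; isYes≗does; does-⇔)

T-injective : ∀ {x y} → (T x → T y) → (T y → T x) → x ≡ y
T-injective to from = does-⇔ (mk⇔ to from) (T? _) (T? _)

T-not : ∀ {x} → T (not x) ⇔ (¬ T x)
T-not {true}  = mk⇔ (λ ()) (λ ¬tt → ¬tt _)
T-not {false} = mk⇔ (λ _ ()) _

anyFin⁺ : ∀ {n} (p : Fin n → Bool) a → T (p a) → T (anyFin p)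
anyFin⁺ p zero    pa = Equivalence.from T-∨ (inj₁ pa)
anyFin⁺ p (suc a) pa = Equivalence.from T-∨ (inj₂ (anyFin⁺ (p ∘ suc) a pa))

anyFin⁻ : ∀ {n} (p : Fin n → Bool) → T (anyFin p) → ∃ λ a → T (p a)
anyFin⁻ {suc n} p h with Equivalence.to (T-∨ {p zero}) h
... | inj₁ p0 = zero , p0
... | inj₂ ps = let a , pa = anyFin⁻ (p ∘ suc) ps in suc a , pa

anyFin-cong : ∀ {n} {p q : Fin n → Bool} → (∀ a → p a ≡ q a) → anyFin p ≡ anyFin q
anyFin-cong {zero}  p≗q = refl
anyFin-cong {suc n} p≗q = cong₂ _∨_ (p≗q zero) (anyFin-cong (p≗q ∘ suc))

countFin-cong : ∀ {n} {p q : Fin n → Bool} → (∀ a → p a ≡ q a) → countFin p ≡ countFin q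
countFin-cong {zero}  p≗q = refl
countFin-cong {suc n} p≗q rewrite p≗q zero = cong (_ +_) (countFin-cong (p≗q ∘ suc))

countFin≡length-select : ∀ {n} (p : Fin n → Bool) → countFin p ≡ length (select p)
countFin≡length-select {zero}  p = refl
countFin≡length-select {suc n} p with p zero
... | true  = cong suc (trans (countFin≡length-select (p ∘ suc)) (sym (L.length-map F.suc (select (p ∘ suc)))))
... | false = trans (countFin≡length-select (p ∘ suc)) (sym (L.length-map F.suc (select (p ∘ suc))))

suc∈map-suc : ∀ {n} {a : Fin n} {xs} → suc a ∈ map suc xs ⇔ a ∈ xs
suc∈map-suc {a = a} {xs} = mk⇔ (λ m → from-map (∈-map⁻ F.suc m)) (∈-map⁺ F.suc)
  where from-map : ∃ (λ b → b ∈ xs × suc a ≡ suc b) → a ∈ xs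
        from-map (_ , a∈xs , refl) = a∈xs

suc∈select : ∀ {n} (p : Fin (suc n) → Bool) {a} → suc a ∈ select p ⇔ a ∈ select (p ∘ suc)
suc∈select p with p zero
... | true  = mk⇔ (λ { (here ()) ; (there m) → Equivalence.to suc∈map-suc m })
                  (there ∘ Equivalence.from suc∈map-suc)
... | false = suc∈map-suc

∈-select : ∀ {n} (p : Fin n → Bool) {a} → a ∈ select p ⇔ T (p a)
∈-select {suc n} p {zero} with p zero
... | true  = mk⇔ _ (λ _ → here refl)
... | false = mk⇔ (λ m → zero∉map-suc (∈-map⁻ F.suc m)) λ ()
  where zero∉map-suc : ∀ {xs : List (Fin n)} → ∃ (λ b → b ∈ xs × zero ≡ suc b) → ⊥
        zero∉map-suc (_ , _ , ())
∈-select {suc n} p {suc a} = ⇔-trans (suc∈select p) (∈-select (p ∘ suc))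

Increasing : ∀ {n} → List (Fin n) → Set
Increasing = AllPairs F._<_

map-suc-increasing : ∀ {n} {xs : List (Fin n)} → Increasing xs → Increasing (map F.suc xs)
map-suc-increasing = AllPairs.map⁺ ∘ AllPairs.map ℕ.s<s

select-increasing : ∀ {n} (p : Fin n → Bool) → Increasing (select p)
select-increasing {zero}  p = []
select-increasing {suc n} p with p zero
... | true  = All.map⁺ (All.universal (λ _ → ℕ.z<s) _)
            ∷ map-suc-increasing (select-increasing (p ∘ suc))
... | false = map-suc-increasing (select-increasing (p ∘ suc))

increasing-unique : ∀ {n} {xs : List (Fin n)} → Increasing xs → Unique xs
increasing-unique = AllPairs.map (λ i<j i≡j → F.<-irrefl i≡j i<j)

increasing-lookup : ∀ {n} {xs : List (Fin n)} → Increasing xs →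
                    ∀ {i j} → i F.< j → L.lookup xs i F.< L.lookup xs j
increasing-lookup (x<xs ∷ _)  {zero}  {suc j} _         = All.lookup x<xs (∈-lookup j)
increasing-lookup (_ ∷ xs↗) {suc i} {suc j} (s≤s i<j) = increasing-lookup xs↗ i<j

countFin-unique : ∀ {n} (p : Fin n → Bool) {xs} → Unique xs → (∀ {a} → a ∈ xs ⇔ T (p a)) →
                  countFin p ≡ length xs
countFin-unique p xs-unique ∈xs⇔p = trans (countFin≡length-select p) (↭-length (∼bag⇒↭ select∼xs))
  where select∼xs = unique∧set⇒bag (increasing-unique (select-increasing p)) xs-unique
                      (⇔-trans (∈-select p) (⇔-sym ∈xs⇔p))

record Enumeration {m n} (r : Fin m → ℕ) (P : Fin m → Bool) (g : Fin n → Fin m) : Set where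
  field
    increasing : ∀ {i j} → i F.< j → r (g i) ℕ.< r (g j)
    sound      : ∀ j → T (P (g j))
    complete   : ∀ {b} → T (P b) → ∃ λ j → g j ≡ b

module _ {m n} {r : Fin m → ℕ} {P : Fin m → Bool} {g : Fin n → Fin m} (E : Enumeration r P g) where
  open Enumeration E

  enumeration-≤⇔ : ∀ {i j} → i F.≤ j ⇔ r (g i) ℕ.≤ r (g j)
  enumeration-≤⇔ {i} {j} = mk⇔ monotone reflecting
    where
    monotone : i F.≤ j → r (g i) ℕ.≤ r (g j)
    monotone i≤j with ℕ.m≤n⇒m<n∨m≡n i≤j
    ... | inj₁ i<j = ℕ.<⇒≤ (increasing i<j)
    ... | inj₂ i≡j = ℕ.≤-reflexive (cong (r ∘ g) (F.toℕ-injective i≡j))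
    reflecting : r (g i) ℕ.≤ r (g j) → i F.≤ j
    reflecting gi≤gj = ℕ.≮⇒≥ (λ j<i → ℕ.<⇒≱ (increasing j<i) gi≤gj)

  enumeration-injective : ∀ {i j} → g i ≡ g j → i ≡ j
  enumeration-injective gi≡gj = F.≤-antisym (≤-from-≡ gi≡gj) (≤-from-≡ (sym gi≡gj))
    where ≤-from-≡ : ∀ {i j} → g i ≡ g j → i F.≤ j
          ≤-from-≡ gi≡gj = Equivalence.from enumeration-≤⇔ (ℕ.≤-reflexive (cong r gi≡gj))

  enumeration-≤ᵇ : ∀ i j → (toℕ i ≤ᵇ toℕ j) ≡ (r (g i) ≤ᵇ r (g j))
  enumeration-≤ᵇ i j = does-⇔ enumeration-≤⇔ (toℕ i ℕ.≤? toℕ j) (r (g i) ℕ.≤? r (g j))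

  enumeration-≟ : ∀ i j → ⌊ i ≟ j ⌋ ≡ ⌊ g i ≟ g j ⌋
  enumeration-≟ i j = begin
    ⌊ i ≟ j ⌋          ≡⟨ isYes≗does (i ≟ j) ⟩
    does (i ≟ j)       ≡⟨ does-⇔ (mk⇔ (cong g) enumeration-injective) (i ≟ j) (g i ≟ g j) ⟩
    does (g i ≟ g j)   ≡⟨ isYes≗does (g i ≟ g j) ⟨
    ⌊ g i ≟ g j ⌋      ∎
    where open ≡-Reasoning

  countFin-enumeration : countFin P ≡ n
  countFin-enumeration = trans (countFin-unique P tabulate-unique ∈tabulate⇔P) (L.length-tabulate g)
    where
    tabulate-unique : Unique (L.tabulate g)
    tabulate-unique = AllPairs.tabulate⁺ (λ i≢j gi≡gj → i≢j (enumeration-injective gi≡gj))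
    ∈tabulate⇔P : ∀ {b} → b ∈ L.tabulate g ⇔ T (P b)
    ∈tabulate⇔P = mk⇔ (λ b∈ → let j , b≡gj = ∈-tabulate⁻ b∈ in subst (T ∘ P) (sym b≡gj) (sound j))
                      (λ Pb → let j , gj≡b = complete Pb in subst (_∈ _) gj≡b (∈-tabulate⁺ j))

  anyFin-enumeration : (q : Fin m → Bool) → anyFin (λ b → P b ∧ q b) ≡ anyFin (q ∘ g)
  anyFin-enumeration q = T-injective restrict extend
    where
    restrict : T (anyFin (λ b → P b ∧ q b)) → T (anyFin (q ∘ g))
    restrict h with anyFin⁻ _ h
    ... | b , Pb∧qb with Equivalence.to (T-∧ {P b}) Pb∧qb
    ...   | Pb , qb with complete Pb
    ...     | j , refl = anyFin⁺ (q ∘ g) j qb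
    extend : T (anyFin (q ∘ g)) → T (anyFin (λ b → P b ∧ q b))
    extend h with anyFin⁻ _ h
    ... | j , qgj = anyFin⁺ _ (g j) (Equivalence.from T-∧ (sound j , qgj))

  enumeration-prefix : (a : Fin n) →
    Enumeration r (λ b → P b ∧ (r b ≤ᵇ r (g a))) (g ∘ λ i → F.inject≤ i (F.toℕ<n a))
  enumeration-prefix a = record { increasing = increasing ∘ inject≤-<
                                ; sound = sound′ ; complete = complete′ }
    where
    inject≤-< : ∀ {i j} → i F.< j → F.inject≤ i (F.toℕ<n a) F.< F.inject≤ j (F.toℕ<n a)
    inject≤-< {i} {j} = subst₂ ℕ._<_ (sym (F.toℕ-inject≤ i _)) (sym (F.toℕ-inject≤ j _))
    sound′ : ∀ i → T (P (g (F.inject≤ i _)) ∧ (r (g (F.inject≤ i _)) ≤ᵇ r (g a)))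
    sound′ i = Equivalence.from T-∧ (sound _ , ℕ.≤⇒≤ᵇ (Equivalence.to enumeration-≤⇔ i≤a))
      where i≤a : F.inject≤ i (F.toℕ<n a) F.≤ a
            i≤a = subst (ℕ._≤ toℕ a) (sym (F.toℕ-inject≤ i _)) (ℕ.≤-pred (F.toℕ<n i))
    complete′ : ∀ {b} → T (P b ∧ (r b ≤ᵇ r (g a))) → ∃ λ i → g (F.inject≤ i _) ≡ b
    complete′ {b} h with Equivalence.to (T-∧ {P b}) h
    ... | Pb , b≤a with complete Pb
    ...   | j , refl = F.fromℕ< (s≤s j≤a) , cong g (F.toℕ-injective inject≤-fromℕ<)
      where
      j≤a : j F.≤ a
      j≤a = Equivalence.from enumeration-≤⇔ (ℕ.≤ᵇ⇒≤ _ _ b≤a)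
      inject≤-fromℕ< : toℕ (F.inject≤ (F.fromℕ< (s≤s j≤a)) (F.toℕ<n a)) ≡ toℕ j
      inject≤-fromℕ< = trans (F.toℕ-inject≤ _ _) (F.toℕ-fromℕ< (s≤s j≤a))

countFin-rank : ∀ {m n} {r : Fin m → ℕ} {P : Fin m → Bool} {g : Fin n → Fin m} → Enumeration r P g →
                ∀ a → countFin (λ b → P b ∧ (r b ≤ᵇ r (g a))) ≡ suc (toℕ a)
countFin-rank E a = countFin-enumeration (enumeration-prefix E a)

-- The paper's (𝔐,f)|U for U the image of g: as g lists U in increasing f-order, f_U is the identity.
induced : ∀ {σ m n} → (Fin (suc n) → Fin m) → ((i : Sym σ) → Vec (Fin m) (ar σ i) → Bool) →
          BrModel σ
induced {n = n} g ψ = record { size-1 = n ; ord = ↔-refl ; rel = λ i us → ψ i (V.map g us) }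

evalRestricted : (S : ℕ → Bool) → ∀ {σ m n} → FOleS σ 0 → (Fin n → Fin m) →
                 ((i : Sym σ) → Vec (Fin m) (ar σ i) → Bool) → Bool
evalRestricted S {n = zero}  φ g ψ = false
evalRestricted S {n = suc n} φ g ψ = evalFO S φ (induced g ψ) []

module _ {m} (ordM : Fin (suc m) ↔ Fin (suc m)) (P : Fin (suc m) → Bool) where
  open Inverse ordM using (to; from; strictlyInverseˡ; strictlyInverseʳ)

  listed : List (Fin (suc m))
  listed = select (P ∘ from)

  listing : Fin (length listed) → Fin (suc m)
  listing = from ∘ L.lookup listed

  listing-enumeration : Enumeration (toℕ ∘ to) P listing
  listing-enumeration = record { increasing = increasing ; sound = sound ; complete = complete }
    where
    increasing : ∀ {i j} → i F.< j → toℕ (to (listing i)) ℕ.< toℕ (to (listing j))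
    increasing {i} {j} i<j rewrite strictlyInverseˡ (L.lookup listed i) | strictlyInverseˡ (L.lookup listed j)
      = increasing-lookup (select-increasing (P ∘ from)) i<j
    sound : ∀ j → T (P (listing j))
    sound j = Equivalence.to (∈-select (P ∘ from)) (∈-lookup j)
    complete : ∀ {b} → T (P b) → ∃ λ j → listing j ≡ b
    complete {b} Pb = Any.index to-b∈ , trans (cong from (sym (lookup-index to-b∈))) (strictlyInverseʳ b)
      where to-b∈ : to b ∈ listed
            to-b∈ = Equivalence.from (∈-select (P ∘ from)) (subst (T ∘ P) (sym (strictlyInverseʳ b)) Pb)

  evalQreg-listing : ∀ S {σ} φ ψ → evalQreg S σ φ ordM P ψ ≡ evalRestricted S φ listing ψ
  evalQreg-listing S φ ψ with listed
  ... | []    = refl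
  ... | _ ∷ _ = refl

ext : ∀ {a b} → (Fin a → Fin b) → Fin (suc a) → Fin (suc b)
ext ρ zero    = zero
ext ρ (suc i) = suc (ρ i)

rename : ∀ {τ a b} → (Fin a → Fin b) → FOC τ a → FOC τ b
rename ρ (eqC x y)   = eqC (ρ x) (ρ y)
rename ρ (relC i xs) = relC i (V.map ρ xs)
rename ρ (leC x y)   = leC (ρ x) (ρ y)
rename ρ (negC φ)    = negC (rename ρ φ)
rename ρ (andC φ ψ)  = andC (rename ρ φ) (rename ρ ψ)
rename ρ (exC φ)     = exC (rename (ext ρ) φ)
rename ρ (cntC φ)    = cntC (rename (ext ρ) φ)

ext-lookup : ∀ {A : Set} {a b} {ρ : Fin a → Fin b} {e : Vec A b} {e′ : Vec A a} x →
             (∀ i → lookup e′ i ≡ lookup e (ρ i)) →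
             ∀ i → lookup (x ∷ e′) i ≡ lookup (x ∷ e) (ext ρ i)
ext-lookup x e′≗eρ zero    = refl
ext-lookup x e′≗eρ (suc i) = e′≗eρ i

rename-correct : ∀ S {τ a b} (ρ : Fin a → Fin b) (φ : FOC τ a) (M : BrModel τ)
                 (e : Vec (Dom M) b) (e′ : Vec (Dom M) a) →
                 (∀ i → lookup e′ i ≡ lookup e (ρ i)) → evalC S φ M e′ ≡ evalC S (rename ρ φ) M e
rename-correct S ρ (eqC x y)   M e e′ e′≗eρ rewrite e′≗eρ x | e′≗eρ y = refl
rename-correct S ρ (relC i xs) M e e′ e′≗eρ =
  cong (rel M i) (trans (V.map-cong e′≗eρ xs) (V.map-∘ (lookup e) ρ xs))
rename-correct S ρ (leC x y)   M e e′ e′≗eρ rewrite e′≗eρ x | e′≗eρ y = refl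
rename-correct S ρ (negC φ)    M e e′ e′≗eρ = cong not (rename-correct S ρ φ M e e′ e′≗eρ)
rename-correct S ρ (andC φ ψ)  M e e′ e′≗eρ =
  cong₂ _∧_ (rename-correct S ρ φ M e e′ e′≗eρ) (rename-correct S ρ ψ M e e′ e′≗eρ)
rename-correct S ρ (exC φ)     M e e′ e′≗eρ =
  anyFin-cong λ x → rename-correct S (ext ρ) φ M (x ∷ e) (x ∷ e′) (ext-lookup x e′≗eρ)
rename-correct S ρ (cntC φ)    M e e′ e′≗eρ =
  cong (inSucc S) (countFin-cong λ x →
    rename-correct S (ext ρ) φ M (x ∷ e) (x ∷ e′) (ext-lookup x e′≗eρ))

lookup-map-++ˡ : ∀ {A B : Set} {j k} (g : A → B) (d : Vec A j) (e : Vec B k) x →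
                lookup (V.map g d ++ e) (x ↑ˡ k) ≡ g (lookup d x)
lookup-map-++ˡ g d e x = trans (V.lookup-++ˡ (V.map g d) e x) (V.lookup-map x g d)

weakenUnder : ∀ {k} j → Fin (suc k) → Fin (suc (j + k))
weakenUnder j = ext (j ↑ʳ_)

instantiate : ∀ {k j m} → Vec (Fin j) m → Fin (m + k) → Fin (j + k)
instantiate {k} {j} {m} xs = [ (λ u → lookup xs u ↑ˡ k) , j ↑ʳ_ ]′ ∘ F.splitAt m

relativize : ∀ {τ σ k j} → FOC τ (suc k) → ((i : Sym σ) → FOC τ (ar σ i + k)) →
             FOleS σ j → FOC τ (j + k)
relativize {k = k} P Ψ (eqF x y)   = eqC (x ↑ˡ k) (y ↑ˡ k)
relativize         P Ψ (relF i xs) = rename (instantiate xs) (Ψ i)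
relativize {k = k} P Ψ (leF x y)   = leC (x ↑ˡ k) (y ↑ˡ k)
relativize {k = k} {j} P Ψ (SF x)  = cntC (andC (rename (weakenUnder j) P) (leC zero (suc (x ↑ˡ k))))
relativize         P Ψ (negF φ)    = negC (relativize P Ψ φ)
relativize         P Ψ (andF φ ψ)  = andC (relativize P Ψ φ) (relativize P Ψ ψ)
relativize {j = j} P Ψ (exF φ)     = exC (andC (rename (weakenUnder j) P) (relativize P Ψ φ))

module _ (S : ℕ → Bool) {τ} (M : BrModel τ) {k} (e : Vec (Dom M) k) {σ : Voc}
         (P′ : FOC τ (suc k)) (Ψ′ : (i : Sym σ) → FOC τ (ar σ i + k))
         {Pb : Dom M → Bool} {ψb : (i : Sym σ) → Vec (Dom M) (ar σ i) → Bool}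
         (P′-defines : ∀ a → Pb a ≡ evalC S P′ M (a ∷ e))
         (Ψ′-defines : ∀ i us → ψb i us ≡ evalC S (Ψ′ i) M (us ++ e)) where

  weakened-defines : ∀ {j} (d : Vec (Dom M) j) b →
                     evalC S (rename (weakenUnder j) P′) M (b ∷ (d ++ e)) ≡ Pb b
  weakened-defines d b =
    sym (trans (P′-defines b) (rename-correct S _ P′ M (b ∷ (d ++ e)) (b ∷ e) lookup-weaken))
    where lookup-weaken : ∀ i → lookup (b ∷ e) i ≡ lookup (b ∷ (d ++ e)) (weakenUnder _ i)
          lookup-weaken zero    = refl
          lookup-weaken (suc i) = sym (V.lookup-++ʳ d e i)

  module _ {n} {g : Fin (suc n) → Dom M} (E : Enumeration (f M) Pb g) where

    relativize-correct : ∀ {j} (χ : FOleS σ j) (d : Vec (Fin (suc n)) j) →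
                         evalFO S χ (induced g ψb) d ≡ evalC S (relativize P′ Ψ′ χ) M (V.map g d ++ e)
    relativize-correct (eqF x y) d =
      trans (enumeration-≟ E _ _)
            (sym (cong₂ (λ a b → ⌊ a ≟ b ⌋) (lookup-map-++ˡ g d e x) (lookup-map-++ˡ g d e y)))
    relativize-correct {j} (relF i xs) d =
      trans (Ψ′-defines i args)
            (rename-correct S (instantiate xs) (Ψ′ i) M (V.map g d ++ e) (args ++ e) lookup-instantiate)
      where
      args : Vec (Dom M) (ar σ i)
      args = V.map g (V.map (lookup d) xs)
      lookup-instantiate : ∀ u → lookup (args ++ e) u ≡ lookup (V.map g d ++ e) (instantiate xs u)
      lookup-instantiate u rewrite V.lookup-splitAt (ar σ i) args e u with F.splitAt (ar σ i) u
      ... | inj₁ v = begin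
        lookup args v                                ≡⟨ V.lookup-map v g (V.map (lookup d) xs) ⟩
        g (lookup (V.map (lookup d) xs) v)           ≡⟨ cong g (V.lookup-map v (lookup d) xs) ⟩
        g (lookup d (lookup xs v))                   ≡⟨ lookup-map-++ˡ g d e (lookup xs v) ⟨
        lookup (V.map g d ++ e) (lookup xs v ↑ˡ k)   ∎
        where open ≡-Reasoning
      ... | inj₂ v = sym (V.lookup-++ʳ (V.map g d) e v)
    relativize-correct (leF x y) d =
      trans (enumeration-≤ᵇ E _ _)
            (sym (cong₂ (λ a b → f M a ≤ᵇ f M b) (lookup-map-++ˡ g d e x) (lookup-map-++ˡ g d e y)))
    relativize-correct {j} (SF x) d = sym (cong (inSucc S) (begin
      countFin (λ b → evalC S (rename (weakenUnder j) P′) M (b ∷ V.map g d ++ e)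
                      ∧ (f M b ≤ᵇ f M (lookup (V.map g d ++ e) (x ↑ˡ k))))
        ≡⟨ countFin-cong (λ b → cong₂ _∧_ (weakened-defines (V.map g d) b)
                                         (cong (λ a → f M b ≤ᵇ f M a) (lookup-map-++ˡ g d e x))) ⟩
      countFin (λ b → Pb b ∧ (f M b ≤ᵇ f M (g (lookup d x))))
        ≡⟨ countFin-rank E (lookup d x) ⟩
      suc (toℕ (lookup d x)) ∎))
      where open ≡-Reasoning
    relativize-correct (negF χ) d = cong not (relativize-correct χ d)
    relativize-correct (andF χ ψ) d = cong₂ _∧_ (relativize-correct χ d) (relativize-correct ψ d)
    relativize-correct {j} (exF χ) d = begin
      anyFin (λ a → evalFO S χ (induced g ψb) (a ∷ d))
        ≡⟨ anyFin-cong (λ a → relativize-correct χ (a ∷ d)) ⟩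
      anyFin (q ∘ g)
        ≡⟨ anyFin-enumeration E q ⟨
      anyFin (λ b → Pb b ∧ q b)
        ≡⟨ anyFin-cong (λ b → cong (_∧ q b) (weakened-defines (V.map g d) b)) ⟨
      anyFin (λ b → evalC S (rename (weakenUnder j) P′) M (b ∷ V.map g d ++ e) ∧ q b) ∎
      where
      open ≡-Reasoning
      q : Dom M → Bool
      q b = evalC S (relativize P′ Ψ′ χ) M (b ∷ V.map g d ++ e)

  evalRestricted-relativize : ∀ {n} {g : Fin n → Dom M} → Enumeration (f M) Pb g → (φ : FOleS σ 0) →
    evalRestricted S φ g ψb
      ≡ anyFin (λ a → evalC S P′ M (a ∷ e)) ∧ evalC S (relativize P′ Ψ′ φ) M e
  evalRestricted-relativize {zero} E φ =
    sym (cong (_∧ evalC S (relativize P′ Ψ′ φ) M e) (T-injective no-witness λ ()))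
    where
    no-witness : T (anyFin (λ a → evalC S P′ M (a ∷ e))) → T false
    no-witness h with anyFin⁻ (λ a → evalC S P′ M (a ∷ e)) h
    ... | a , P′a with Enumeration.complete E (subst T (sym (P′-defines a)) P′a)
    ...   | () , _
  evalRestricted-relativize {suc n} {g} E φ =
    trans (relativize-correct E φ [])
          (sym (cong (_∧ evalC S (relativize P′ Ψ′ φ) M e) (T-injective _ (λ _ → witness))))
    where
    witness : T (anyFin (λ a → evalC S P′ M (a ∷ e)))
    witness = anyFin⁺ (λ a → evalC S P′ M (a ∷ e)) (g zero)
                      (subst T (P′-defines (g zero)) (Enumeration.sound E zero))

toFOC : ∀ {S τ k} → RC S τ k → FOC τ k
toFOC (eqR x y)      = eqC x y
toFOC (relR i xs)    = relC i xs
toFOC (leR x y)      = leC x y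
toFOC (negR φ)       = negC (toFOC φ)
toFOC (andR φ ψ)     = andC (toFOC φ) (toFOC ψ)
toFOC (exR φ)        = exC (toFOC φ)
toFOC (qreg σ φ P ψ) = andC (exC (toFOC P)) (relativize (toFOC P) (toFOC ∘ ψ) φ)

toFOC-correct : ∀ S {τ k} (φ : RC S τ k) (M : BrModel τ) (e : Vec (Dom M) k) →
                evalRC S φ M e ≡ evalC S (toFOC φ) M e
toFOC-correct S (eqR x y)   M e = refl
toFOC-correct S (relR i xs) M e = refl
toFOC-correct S (leR x y)   M e = refl
toFOC-correct S (negR φ)    M e = cong not (toFOC-correct S φ M e)
toFOC-correct S (andR φ ψ)  M e = cong₂ _∧_ (toFOC-correct S φ M e) (toFOC-correct S ψ M e)
toFOC-correct S (exR φ)     M e = anyFin-cong λ a → toFOC-correct S φ M (a ∷ e)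
toFOC-correct S (qreg σ φ P ψ) M e = trans (evalQreg-listing (ord M) Pb S φ ψb)
  (evalRestricted-relativize S M e (toFOC P) (toFOC ∘ ψ)
    (λ a → toFOC-correct S P M (a ∷ e)) (λ i us → toFOC-correct S (ψ i) M (us ++ e))
    (listing-enumeration (ord M) Pb) φ)
  where
  Pb : Dom M → Bool
  Pb a = evalRC S P M (a ∷ e)
  ψb : (i : Sym σ) → Vec (Dom M) (ar σ i) → Bool
  ψb i us = evalRC S (ψ i) M (us ++ e)

maxInS : FOleS [] 0
maxInS = exF (andF (SF zero) (negF (exF (negF (leF zero (suc zero))))))

maxInS-correct : ∀ S (M : BrModel []) → evalFO S maxInS M [] ≡ S (size-1 M)
maxInS-correct S M = T-injective holds⇒S holds⇐S
  where
  n = size-1 M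
  top : Dom M
  top = Inverse.from (ord M) (F.fromℕ n)
  f-top : f M top ≡ n
  f-top = trans (cong toℕ (Inverse.strictlyInverseˡ (ord M) _)) (F.toℕ-fromℕ n)
  f≤n : ∀ b → f M b ℕ.≤ n
  f≤n b = ℕ.≤-pred (F.toℕ<n (Inverse.to (ord M) b))
  above : Dom M → Bool
  above a = anyFin (λ b → not (f M b ≤ᵇ f M a))
  maximalInS : Dom M → Bool
  maximalInS a = S (f M a) ∧ not (above a)
  holds⇒S : T (evalFO S maxInS M []) → T (S n)
  holds⇒S h with anyFin⁻ maximalInS h
  ... | a , Sa∧¬above with Equivalence.to (T-∧ {S (f M a)}) Sa∧¬above
  ...   | Sa , ¬above = subst (T ∘ S) (ℕ.≤-antisym (f≤n a) n≤fa) Sa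
    where
    n≤fa : n ℕ.≤ f M a
    n≤fa = ℕ.≮⇒≥ λ fa<n → Equivalence.to T-not ¬above (anyFin⁺ (λ b → not (f M b ≤ᵇ f M a)) top
             (Equivalence.from T-not λ top≤a →
               ℕ.<⇒≱ fa<n (subst (ℕ._≤ f M a) f-top (ℕ.≤ᵇ⇒≤ _ _ top≤a))))
  holds⇐S : T (S n) → T (evalFO S maxInS M [])
  holds⇐S Sn = anyFin⁺ maximalInS top
    (Equivalence.from T-∧ (subst (T ∘ S) (sym f-top) Sn , Equivalence.from T-not none-above))
    where
    none-above : ¬ T (above top)
    none-above h with anyFin⁻ (λ b → not (f M b ≤ᵇ f M top)) h
    ... | b , b≰top =
      Equivalence.to T-not b≰top (ℕ.≤⇒≤ᵇ (subst (f M b ℕ.≤_) (sym f-top) (f≤n b)))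

evalRestricted-maxInS : ∀ S {m n} (g : Fin n → Fin m)
                        (ψ : (i : Sym []) → Vec (Fin m) (ar [] i) → Bool) →
                        evalRestricted S maxInS g ψ ≡ inSucc S n
evalRestricted-maxInS S {n = zero}  g ψ = refl
evalRestricted-maxInS S {n = suc n} g ψ = maxInS-correct S (induced g ψ)

toRC : ∀ {S τ k} → FOC τ k → RC S τ k
toRC (eqC x y)   = eqR x y
toRC (relC i xs) = relR i xs
toRC (leC x y)   = leR x y
toRC (negC φ)    = negR (toRC φ)
toRC (andC φ ψ)  = andR (toRC φ) (toRC ψ)
toRC (exC φ)     = exR (toRC φ)
toRC (cntC φ)    = qreg [] maxInS (toRC φ) λ ()

toRC-correct : ∀ S {τ k} (φ : FOC τ k) (M : BrModel τ) (e : Vec (Dom M) k) →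
               evalC S φ M e ≡ evalRC S (toRC φ) M e
toRC-correct S (eqC x y)   M e = refl
toRC-correct S (relC i xs) M e = refl
toRC-correct S (leC x y)   M e = refl
toRC-correct S (negC φ)    M e = cong not (toRC-correct S φ M e)
toRC-correct S (andC φ ψ)  M e = cong₂ _∧_ (toRC-correct S φ M e) (toRC-correct S ψ M e)
toRC-correct S (exC φ)     M e = anyFin-cong λ a → toRC-correct S φ M (a ∷ e)
toRC-correct S (cntC φ)    M e = begin
  inSucc S (countFin (λ a → evalC S φ M (a ∷ e)))
    ≡⟨ cong (inSucc S) (countFin-cong λ a → toRC-correct S φ M (a ∷ e)) ⟩
  inSucc S (countFin Pb)
    ≡⟨ cong (inSucc S) (countFin-enumeration (listing-enumeration (ord M) Pb)) ⟩
  inSucc S (length (listed (ord M) Pb))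
    ≡⟨ trans (evalQreg-listing (ord M) Pb S maxInS _) (evalRestricted-maxInS S (listing (ord M) Pb) _) ⟨
  evalRC S (toRC (cntC φ)) M e
    ∎
  where
  open ≡-Reasoning
  Pb : Dom M → Bool
  Pb a = evalRC S (toRC φ) M (a ∷ e)

proposition5p7 : (S : ℕ → Bool) → RC≤FOC S × FOC≤RC S
proposition5p7 S = (λ τ φ → toFOC φ , λ M → toFOC-correct S φ M [])
                 , (λ τ ψ → toRC ψ , λ M → toRC-correct S ψ M [])
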